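{- Let $t>1$ be odd and let $k_0,k_1,k_2,k_3$ be integers with $\frac{t-1}{2}\ge k_0\ge k_1\ge k_2\ge k_3\ge0$ and $\sum_{i=0}^3\frac{k_i(t-k_i)}{2}=\frac{t(t-1)}{2}$. Let $n=k_0+k_1+k_2+k_3$. Then (1) $\big\lceil\frac{t-\sqrt{4t-3}}{2}\big\rceil\le k_3\le\big\lfloor\frac{t+\sqrt{4t-3}}{2}\big\rfloor$; (2) $\lceil 2(t-\sqrt{t})\rceil\le n\le\lfloor 2(t+\sqrt{t})\rfloor$.
   Context: Such a tuple $\big(\frac{k_i(t-k_i)}{2}\big)_{i=0}^3$ is called a distribution for $t$. -}

module Defs where

open import Data.Nat as ℕ using (ℕ; _+_; _*_)
open import Data.Integer as ℤ using (ℤ; +_)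
open import Data.Product using (∃; _×_)
open import Data.Sum using (_⊎_)
open import Relation.Binary.PropositionalEquality using (_≡_)

Odd : ℕ → Set
Odd t = ∃ λ m → t ≡ 2 * m + 1

-- x ≤ √y  (real square root of the natural number y), for an integer x.
-- Either x ≤ 0 (then trivially x ≤ 0 ≤ √y), or x > 0 and x² ≤ y.
LeSqrt : ℤ → ℕ → Set
LeSqrt x y = x ℤ.≤ + 0 ⊎ (+ 0 ℤ.< x × x ℤ.* x ℤ.≤ + y)

-- Writing dᵢ = t − 2kᵢ, the identity (t − 2k)² + 4k(t − k) = t² turns the hypothesis
-- Σ kᵢ(t − kᵢ) = t(t − 1) into Σ dᵢ² = 4t. Since 2kᵢ < t every dᵢ is at least 1, so
-- d₃² ≤ 4t − 3, which is (1). For (2), 2(2t − n) = Σ dᵢ, and the quadratic-mean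
-- inequality (Σ dᵢ)² ≤ 4 Σ dᵢ² gives (2t − n)² ≤ 4t. The remaining two bounds only
-- say 2k₃ ≤ t and n ≤ 2t.
module Submission where

open import Defs
open import Data.Nat using (ℕ; _+_; _*_; _∸_; _≤_; _<_)
open import Data.Integer as ℤ using (+_)
open import Data.Product using (_×_)
open import Relation.Binary.PropositionalEquality using (_≡_)

open import Data.Nat using (zero; suc; s≤s; z≤n)
open import Data.Nat.Properties
open import Data.Nat.Tactic.RingSolver using (solve-∀)
import Data.Integer.Properties as ℤₚ
open import Data.Product using (_,_)
open import Data.Sum using (inj₁; inj₂)
open import Relation.Binary.PropositionalEquality
  using (refl; sym; trans; cong; cong₂; subst; subst₂; module ≡-Reasoning)

+m-+n≡+[m∸n] : ∀ {m n} → n ≤ m → + m ℤ.- + n ≡ + (m ∸ n)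
+m-+n≡+[m∸n] {m} {n} n≤m = trans (ℤₚ.m-n≡m⊖n m n) (ℤₚ.≤-⊖ n≤m)

leSqrt-+ : ∀ m {y} → m * m ≤ y → LeSqrt (+ m) y
leSqrt-+ zero        _    = inj₁ ℤₚ.≤-refl
leSqrt-+ m@(suc _) {y} m*m≤y =
  inj₂ (ℤ.+<+ (s≤s z≤n) , subst (ℤ._≤ + y) (sym (ℤₚ.pos-* m m)) (ℤ.+≤+ m*m≤y))

leSqrt-∸ : ∀ {m n y} → n ≤ m → (m ∸ n) * (m ∸ n) ≤ y → LeSqrt (+ m ℤ.- + n) y
leSqrt-∸ n≤m sq≤y = subst (λ x → LeSqrt x _) (sym (+m-+n≡+[m∸n] n≤m)) (leSqrt-+ _ sq≤y)

leSqrt-nonpos : ∀ {m n y} → m ≤ n → LeSqrt (+ m ℤ.- + n) y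
leSqrt-nonpos m≤n = inj₁ (ℤₚ.i≤j⇒i-j≤0 (ℤ.+≤+ m≤n))

m≤n⇒2*m*n≤m*m+n*n : ∀ {m n} → m ≤ n → 2 * m * n ≤ m * m + n * n
m≤n⇒2*m*n≤m*m+n*n {m} m≤n with m≤n⇒∃[o]m+o≡n m≤n
... | o , refl = subst (2 * m * (m + o) ≤_) (sym (expand m o)) (m≤m+n _ (o * o))
  where
  expand : ∀ m o → m * m + (m + o) * (m + o) ≡ 2 * m * (m + o) + o * o
  expand = solve-∀

2*m*n≤m*m+n*n : ∀ m n → 2 * m * n ≤ m * m + n * n
2*m*n≤m*m+n*n m n with ≤-total m n
... | inj₁ m≤n = m≤n⇒2*m*n≤m*m+n*n m≤n
... | inj₂ n≤m = subst₂ _≤_ (2*-comm n m) (+-comm (n * n) (m * m)) (m≤n⇒2*m*n≤m*m+n*n n≤m)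
  where
  2*-comm : ∀ n m → 2 * n * m ≡ 2 * m * n
  2*-comm = solve-∀

square-sum₄≤ : ∀ a b c d →
  (a + b + c + d) * (a + b + c + d) ≤ 4 * (a * a + b * b + c * c + d * d)
square-sum₄≤ a b c d = begin
  (a + b + c + d) * (a + b + c + d)
    ≡⟨ expand a b c d ⟩
  Q + (2 * a * b + 2 * a * c + 2 * a * d + 2 * b * c + 2 * b * d + 2 * c * d)
    ≤⟨ +-monoʳ-≤ Q (+-mono-≤ (+-mono-≤ (+-mono-≤ (+-mono-≤ (+-mono-≤
         (2*m*n≤m*m+n*n a b) (2*m*n≤m*m+n*n a c)) (2*m*n≤m*m+n*n a d))
         (2*m*n≤m*m+n*n b c)) (2*m*n≤m*m+n*n b d)) (2*m*n≤m*m+n*n c d)) ⟩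
  Q + ((a * a + b * b) + (a * a + c * c) + (a * a + d * d)
       + (b * b + c * c) + (b * b + d * d) + (c * c + d * d))
    ≡⟨ collect a b c d ⟩
  4 * Q ∎
  where
  open ≤-Reasoning
  Q = a * a + b * b + c * c + d * d
  expand : ∀ a b c d → (a + b + c + d) * (a + b + c + d)
    ≡ (a * a + b * b + c * c + d * d)
      + (2 * a * b + 2 * a * c + 2 * a * d + 2 * b * c + 2 * b * d + 2 * c * d)
  expand = solve-∀
  collect : ∀ a b c d → (a * a + b * b + c * c + d * d)
      + ((a * a + b * b) + (a * a + c * c) + (a * a + d * d)
         + (b * b + c * c) + (b * b + d * d) + (c * c + d * d))
    ≡ 4 * (a * a + b * b + c * c + d * d)
  collect = solve-∀

2*m≡a+b+c+d⇒m*m≤a*a+b*b+c*c+d*d : ∀ m a b c d → 2 * m ≡ a + b + c + d →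
  m * m ≤ a * a + b * b + c * c + d * d
2*m≡a+b+c+d⇒m*m≤a*a+b*b+c*c+d*d m a b c d 2m≡Σ = *-cancelˡ-≤ 4 (begin
  4 * (m * m)                         ≡⟨ quadruple m ⟩
  2 * m * (2 * m)                     ≡⟨ cong₂ _*_ 2m≡Σ 2m≡Σ ⟩
  (a + b + c + d) * (a + b + c + d)   ≤⟨ square-sum₄≤ a b c d ⟩
  4 * (a * a + b * b + c * c + d * d) ∎)
  where
  open ≤-Reasoning
  quadruple : ∀ m → 4 * (m * m) ≡ 2 * m * (2 * m)
  quadruple = solve-∀

1≤⇒square+3≤sum-of-squares : ∀ {a b c} d → 1 ≤ a → 1 ≤ b → 1 ≤ c →
  d * d + 3 ≤ a * a + b * b + c * c + d * d
1≤⇒square+3≤sum-of-squares d 1≤a 1≤b 1≤c =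
  ≤-trans (≤-reflexive (+-comm (d * d) 3))
    (+-monoˡ-≤ (d * d) (+-mono-≤ (+-mono-≤ (1≤square 1≤a) (1≤square 1≤b)) (1≤square 1≤c)))
  where
  1≤square : ∀ {x} → 1 ≤ x → 1 ≤ x * x
  1≤square 1≤x = *-mono-≤ 1≤x 1≤x

deficit : ℕ → ℕ → ℕ
deficit t k = t ∸ 2 * k

deficit-square : ∀ {t} k → 2 * k ≤ t → deficit t k * deficit t k + 4 * (k * (t ∸ k)) ≡ t * t
deficit-square k 2k≤t with m≤n⇒∃[o]m+o≡n 2k≤t
... | x , refl = begin
  (2 * k + x ∸ 2 * k) * (2 * k + x ∸ 2 * k) + 4 * (k * (2 * k + x ∸ k))
    ≡⟨ cong₂ (λ d e → d * d + 4 * (k * e)) (m+n∸m≡n (2 * k) x) 2*k+x∸k≡k+x ⟩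
  x * x + 4 * (k * (k + x))
    ≡⟨ expand k x ⟩
  (2 * k + x) * (2 * k + x) ∎
  where
  open ≡-Reasoning
  regroup : ∀ k x → 2 * k + x ≡ k + (k + x)
  regroup = solve-∀
  expand : ∀ k x → x * x + 4 * (k * (k + x)) ≡ (2 * k + x) * (2 * k + x)
  expand = solve-∀
  2*k+x∸k≡k+x : 2 * k + x ∸ k ≡ k + x
  2*k+x∸k≡k+x = trans (cong (_∸ k) (regroup k x)) (m+n∸m≡n k (k + x))

split-sum₄ : ∀ (f g : ℕ → ℕ) m k₀ k₁ k₂ k₃ {c} →
  f k₀ + m * g k₀ ≡ c → f k₁ + m * g k₁ ≡ c → f k₂ + m * g k₂ ≡ c → f k₃ + m * g k₃ ≡ c →
  (f k₀ + f k₁ + f k₂ + f k₃) + m * (g k₀ + g k₁ + g k₂ + g k₃) ≡ 4 * c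
split-sum₄ f g m k₀ k₁ k₂ k₃ {c} e₀ e₁ e₂ e₃ = begin
  (f k₀ + f k₁ + f k₂ + f k₃) + m * (g k₀ + g k₁ + g k₂ + g k₃)
    ≡⟨ regroup (f k₀) (f k₁) (f k₂) (f k₃) (g k₀) (g k₁) (g k₂) (g k₃) m ⟩
  (f k₀ + m * g k₀) + (f k₁ + m * g k₁) + (f k₂ + m * g k₂) + (f k₃ + m * g k₃)
    ≡⟨ cong₂ _+_ (cong₂ _+_ (cong₂ _+_ e₀ e₁) e₂) e₃ ⟩
  c + c + c + c
    ≡⟨ four-copies c ⟩
  4 * c ∎
  where
  open ≡-Reasoning
  regroup : ∀ a₀ a₁ a₂ a₃ b₀ b₁ b₂ b₃ m →
    (a₀ + a₁ + a₂ + a₃) + m * (b₀ + b₁ + b₂ + b₃)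
    ≡ (a₀ + m * b₀) + (a₁ + m * b₁) + (a₂ + m * b₂) + (a₃ + m * b₃)
  regroup = solve-∀
  four-copies : ∀ c → c + c + c + c ≡ 4 * c
  four-copies = solve-∀

n*n≡n+n*[n∸1] : ∀ n → n * n ≡ n + n * (n ∸ 1)
n*n≡n+n*[n∸1] zero      = refl
n*n≡n+n*[n∸1] n@(suc m) = *-suc n m

sum-deficit-squares : ∀ {t} k₀ k₁ k₂ k₃ →
  2 * k₀ ≤ t → 2 * k₁ ≤ t → 2 * k₂ ≤ t → 2 * k₃ ≤ t →
  k₀ * (t ∸ k₀) + k₁ * (t ∸ k₁) + k₂ * (t ∸ k₂) + k₃ * (t ∸ k₃) ≡ t * (t ∸ 1) →
  deficit t k₀ * deficit t k₀ + deficit t k₁ * deficit t k₁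
    + deficit t k₂ * deficit t k₂ + deficit t k₃ * deficit t k₃ ≡ 4 * t
sum-deficit-squares {t} k₀ k₁ k₂ k₃ b₀ b₁ b₂ b₃ distribution =
  +-cancelʳ-≡ (4 * (t * (t ∸ 1))) _ _ (begin
    S + 4 * (t * (t ∸ 1))
      ≡⟨ cong (λ p → S + 4 * p) (sym distribution) ⟩
    S + 4 * (k₀ * (t ∸ k₀) + k₁ * (t ∸ k₁) + k₂ * (t ∸ k₂) + k₃ * (t ∸ k₃))
      ≡⟨ split-sum₄ (λ k → deficit t k * deficit t k) (λ k → k * (t ∸ k)) 4 k₀ k₁ k₂ k₃
           (deficit-square k₀ b₀) (deficit-square k₁ b₁) (deficit-square k₂ b₂) (deficit-square k₃ b₃) ⟩
    4 * (t * t)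
      ≡⟨ cong (4 *_) (n*n≡n+n*[n∸1] t) ⟩
    4 * (t + t * (t ∸ 1))
      ≡⟨ *-distribˡ-+ 4 t (t * (t ∸ 1)) ⟩
    4 * t + 4 * (t * (t ∸ 1)) ∎)
  where
  open ≡-Reasoning
  S = deficit t k₀ * deficit t k₀ + deficit t k₁ * deficit t k₁
      + deficit t k₂ * deficit t k₂ + deficit t k₃ * deficit t k₃

sum-deficits : ∀ {t} k₀ k₁ k₂ k₃ →
  2 * k₀ ≤ t → 2 * k₁ ≤ t → 2 * k₂ ≤ t → 2 * k₃ ≤ t →
  (deficit t k₀ + deficit t k₁ + deficit t k₂ + deficit t k₃) + 2 * (k₀ + k₁ + k₂ + k₃) ≡ 4 * t
sum-deficits {t} k₀ k₁ k₂ k₃ b₀ b₁ b₂ b₃ =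
  split-sum₄ (deficit t) (λ k → k) 2 k₀ k₁ k₂ k₃ (m∸n+n≡m b₀) (m∸n+n≡m b₁) (m∸n+n≡m b₂) (m∸n+n≡m b₃)

m+2*n≡4*t⇒n≤2*t : ∀ m n t → m + 2 * n ≡ 4 * t → n ≤ 2 * t
m+2*n≡4*t⇒n≤2*t m n t eq = *-cancelˡ-≤ 2 (begin
  2 * n         ≤⟨ m≤n+m (2 * n) m ⟩
  m + 2 * n     ≡⟨ eq ⟩
  4 * t         ≡⟨ *-assoc 2 2 t ⟩
  2 * (2 * t)   ∎)
  where open ≤-Reasoning

m+2*n≡4*t⇒2*[2*t∸n]≡m : ∀ m n t → m + 2 * n ≡ 4 * t → 2 * (2 * t ∸ n) ≡ m
m+2*n≡4*t⇒2*[2*t∸n]≡m m n t eq = begin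
  2 * (2 * t ∸ n)        ≡⟨ *-distribˡ-∸ 2 (2 * t) n ⟩
  2 * (2 * t) ∸ 2 * n    ≡⟨ cong (_∸ 2 * n) (sym (trans eq (*-assoc 2 2 t))) ⟩
  m + 2 * n ∸ 2 * n      ≡⟨ m+n∸n≡m m (2 * n) ⟩
  m                      ∎
  where open ≡-Reasoning

proposition5 : (t k₀ k₁ k₂ k₃ : ℕ) → 1 < t → Odd t →
    2 * k₀ ≤ t ∸ 1 → k₁ ≤ k₀ → k₂ ≤ k₁ → k₃ ≤ k₂ →
    k₀ * (t ∸ k₀) + k₁ * (t ∸ k₁) + k₂ * (t ∸ k₂) + k₃ * (t ∸ k₃) ≡ t * (t ∸ 1) →
    (LeSqrt (+ t ℤ.- + (2 * k₃)) (4 * t ∸ 3) × LeSqrt (+ (2 * k₃) ℤ.- + t) (4 * t ∸ 3))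
    × (LeSqrt (+ (2 * t) ℤ.- + (k₀ + k₁ + k₂ + k₃)) (4 * t)
       × LeSqrt (+ (k₀ + k₁ + k₂ + k₃) ℤ.- + (2 * t)) (4 * t))
proposition5 zero _ _ _ _ () _ _ _ _ _ _
proposition5 t@(suc _) k₀ k₁ k₂ k₃ _ _ 2k₀≤t∸1 k₁≤k₀ k₂≤k₁ k₃≤k₂ distribution =
  (leSqrt-∸ 2k₃≤t (m+n≤o⇒m≤o∸n _ d₃²+3≤4t) , leSqrt-nonpos 2k₃≤t)
  , (leSqrt-∸ n≤2t [2t∸n]²≤4t , leSqrt-nonpos n≤2t)
  where
  d₀ = deficit t k₀
  d₁ = deficit t k₁
  d₂ = deficit t k₂
  d₃ = deficit t k₃
  n = k₀ + k₁ + k₂ + k₃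
  2k₀<t : 2 * k₀ < t
  2k₀<t = s≤s 2k₀≤t∸1
  2k₁<t : 2 * k₁ < t
  2k₁<t = ≤-<-trans (*-monoʳ-≤ 2 k₁≤k₀) 2k₀<t
  2k₂<t : 2 * k₂ < t
  2k₂<t = ≤-<-trans (*-monoʳ-≤ 2 k₂≤k₁) 2k₁<t
  2k₃≤t : 2 * k₃ ≤ t
  2k₃≤t = <⇒≤ (≤-<-trans (*-monoʳ-≤ 2 k₃≤k₂) 2k₂<t)
  Σd²≡4t : d₀ * d₀ + d₁ * d₁ + d₂ * d₂ + d₃ * d₃ ≡ 4 * t
  Σd²≡4t = sum-deficit-squares k₀ k₁ k₂ k₃ (<⇒≤ 2k₀<t) (<⇒≤ 2k₁<t) (<⇒≤ 2k₂<t) 2k₃≤t distribution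
  Σd+2n≡4t : (d₀ + d₁ + d₂ + d₃) + 2 * n ≡ 4 * t
  Σd+2n≡4t = sum-deficits k₀ k₁ k₂ k₃ (<⇒≤ 2k₀<t) (<⇒≤ 2k₁<t) (<⇒≤ 2k₂<t) 2k₃≤t
  d₃²+3≤4t : d₃ * d₃ + 3 ≤ 4 * t
  d₃²+3≤4t = ≤-trans
    (1≤⇒square+3≤sum-of-squares d₃ (m<n⇒0<n∸m 2k₀<t) (m<n⇒0<n∸m 2k₁<t) (m<n⇒0<n∸m 2k₂<t))
    (≤-reflexive Σd²≡4t)
  n≤2t : n ≤ 2 * t
  n≤2t = m+2*n≡4*t⇒n≤2*t (d₀ + d₁ + d₂ + d₃) n t Σd+2n≡4t
  [2t∸n]²≤4t : (2 * t ∸ n) * (2 * t ∸ n) ≤ 4 * t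
  [2t∸n]²≤4t = ≤-trans
    (2*m≡a+b+c+d⇒m*m≤a*a+b*b+c*c+d*d (2 * t ∸ n) d₀ d₁ d₂ d₃
      (m+2*n≡4*t⇒2*[2*t∸n]≡m (d₀ + d₁ + d₂ + d₃) n t Σd+2n≡4t))
    (≤-reflexive Σd²≡4t)
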